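{- Let $0<\delta<\tfrac12$. Consider the following online algorithm for the Online Simple Knapsack problem with item size estimates and additive accuracy $\delta$: if the largest announced (estimated) size $b'$ among all items satisfies $b'\ge 0.5$, the algorithm rejects every item except one item $b$ with this largest announced size, which it packs when it arrives; otherwise it packs items greedily (each arriving item is packed if and only if it fits into the remaining capacity). This algorithm has competitive ratio at most $\frac{2}{1-2\delta}$.
   Context: Online Simple Knapsack with Item Size Estimates (additive accuracy $\delta\ge 0$): an instance consists of actual item sizes $x_1,\dots,x_n\in[0,1]$ together with estimated sizes $x_1',\dots,x_n'$ satisfying $x_i'-\delta\le x_i\le x_i'+\delta$ for all $i$. A deterministic online algorithm knows $\delta$ and the whole list of estimates from the start. The actual sizes are then revealed one at a time in order. When $x_i$ is revealed, the algorithm must irrevocably either pack it into an initially empty knapsack of capacity $1$ (allowed only if the total size already packed plus $x_i$ is at most $1$) or reject it. The gain of an algorithm is the total size of the packed items; $\mathrm{OPT}$ is the maximum total size of a subset of the actual items with total at most $1$. The competitive ratio of an algorithm $A$ is $\sup \mathrm{OPT}/\mathrm{gain}_A$ over all instances with accuracy $\delta$.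
   Formalization: The accuracy δ, the actual item sizes and the estimated sizes range only over the rationals. -}

module Defs where

open import Data.Nat using (ℕ; zero; suc)
open import Data.Fin using (Fin; zero; suc)
open import Data.Bool using (Bool; true; false; if_then_else_)
open import Data.Product using (Σ; _×_; _,_)
open import Data.Sum using (_⊎_)
open import Data.Rational using (ℚ; 0ℚ; 1ℚ; ½; _+_; _-_; _*_; _≤_; _<_)
open import Data.Rational.Properties using (_≤?_)
open import Relation.Nullary using (yes; no)
open import Relation.Binary.PropositionalEquality using (_≡_)

sumFin : (n : ℕ) → (Fin n → ℚ) → ℚ
sumFin zero    f = 0ℚ
sumFin (suc n) f = f zero + sumFin n (λ i → f (suc i))

subsetSum : (n : ℕ) → (Fin n → ℚ) → (Fin n → Bool) → ℚ
subsetSum n x S = sumFin n (λ i → if S i then x i else 0ℚ)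

Feasible : (n : ℕ) → (Fin n → ℚ) → (Fin n → Bool) → Set
Feasible n x S = subsetSum n x S ≤ 1ℚ

ValidInstance : ℚ → (n : ℕ) → (Fin n → ℚ) → (Fin n → ℚ) → Set
ValidInstance δ n x x' =
  (i : Fin n) → (0ℚ ≤ x i) × (x i ≤ 1ℚ) × (x' i - δ ≤ x i) × (x i ≤ x' i + δ)

greedyFrom : ℚ → (n : ℕ) → (Fin n → ℚ) → ℚ
greedyFrom l zero    x = l
greedyFrom l (suc n) x with l + x zero ≤? 1ℚ
... | yes _ = greedyFrom (l + x zero) n (λ i → x (suc i))
... | no  _ = greedyFrom l n (λ i → x (suc i))

greedyGain : (n : ℕ) → (Fin n → ℚ) → ℚ
greedyGain n x = greedyFrom 0ℚ n x

IsMaxEstimate : (n : ℕ) → (Fin n → ℚ) → Fin n → Set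
IsMaxEstimate n x' j = (i : Fin n) → x' i ≤ x' j

-- Case 1: the largest estimate b' = x' j is ≥ 1/2; the algorithm packs
--   only item j (any item with the largest estimate), gain = x j.
-- Case 2: all estimates are < 1/2 (i.e. the largest is < 1/2, or n = 0);
--   the algorithm packs greedily.
AlgGain : (n : ℕ) → (Fin n → ℚ) → (Fin n → ℚ) → ℚ → Set
AlgGain n x x' g =
  (Σ (Fin n) λ j → IsMaxEstimate n x' j × (½ ≤ x' j) × (g ≡ x j))
  ⊎ (((i : Fin n) → x' i < ½) × (g ≡ greedyGain n x))

-- If the largest estimate is at least ½, the packed item has actual size at least ½ - δ.
-- Otherwise every actual size is below ½ + δ, so greedy either packs every item (and
-- then beats any feasible subset) or rejects one, which leaves its load above ½ - δ.
-- A load of ½ - δ is a (1 - 2δ)/2 fraction of the capacity, hence of OPT ≤ 1.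
module Submission where

open import Defs
open import Data.Nat using (ℕ; zero; suc)
open import Data.Fin using (Fin; zero; suc)
open import Data.Bool using (Bool; true; false; if_then_else_)
open import Data.Product using (_,_)
open import Data.Sum using (_⊎_; inj₁; inj₂)
open import Data.Rational using (ℚ; 0ℚ; 1ℚ; ½; _+_; _-_; _*_; _≤_; _<_; -_; nonNegative)
open import Data.Rational.Properties
open import Data.Rational.Solver using (module +-*-Solver)
open import Relation.Nullary using (yes; no)
open import Relation.Binary.PropositionalEquality using (_≡_; refl; sym; trans)

open +-*-Solver

sumFin-nonNeg : ∀ n {f : Fin n → ℚ} → (∀ i → 0ℚ ≤ f i) → 0ℚ ≤ sumFin n f
sumFin-nonNeg zero    f≥0 = ≤-refl
sumFin-nonNeg (suc n) f≥0 = +-mono-≤ (f≥0 zero) (sumFin-nonNeg n (λ i → f≥0 (suc i)))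

sumFin-mono : ∀ n {f g : Fin n → ℚ} → (∀ i → f i ≤ g i) → sumFin n f ≤ sumFin n g
sumFin-mono zero    f≤g = ≤-refl
sumFin-mono (suc n) f≤g = +-mono-≤ (f≤g zero) (sumFin-mono n (λ i → f≤g (suc i)))

select-nonNeg : ∀ b {p} → 0ℚ ≤ p → 0ℚ ≤ (if b then p else 0ℚ)
select-nonNeg true  p≥0 = p≥0
select-nonNeg false p≥0 = ≤-refl

select≤ : ∀ b {p} → 0ℚ ≤ p → (if b then p else 0ℚ) ≤ p
select≤ true  p≥0 = ≤-refl
select≤ false p≥0 = p≥0

subsetSum-nonNeg : ∀ n {x : Fin n → ℚ} (S : Fin n → Bool) →
  (∀ i → 0ℚ ≤ x i) → 0ℚ ≤ subsetSum n x S
subsetSum-nonNeg n S x≥0 = sumFin-nonNeg n (λ i → select-nonNeg (S i) (x≥0 i))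

subsetSum≤sumFin : ∀ n {x : Fin n → ℚ} (S : Fin n → Bool) →
  (∀ i → 0ℚ ≤ x i) → subsetSum n x S ≤ sumFin n x
subsetSum≤sumFin n S x≥0 = sumFin-mono n (λ i → select≤ (S i) (x≥0 i))

p≤p+q : ∀ p {q} → 0ℚ ≤ q → p ≤ p + q
p≤p+q p q≥0 = ≤-trans (≤-reflexive (sym (+-identityʳ p))) (+-monoʳ-≤ p q≥0)

greedyFrom-≥-load : ∀ l n {x : Fin n → ℚ} → (∀ i → 0ℚ ≤ x i) → l ≤ greedyFrom l n x
greedyFrom-≥-load l zero    x≥0 = ≤-refl
greedyFrom-≥-load l (suc n) {x} x≥0 with l + x zero ≤? 1ℚ
... | yes _ = ≤-trans (p≤p+q l (x≥0 zero)) (greedyFrom-≥-load (l + x zero) n (λ i → x≥0 (suc i)))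
... | no  _ = greedyFrom-≥-load l n (λ i → x≥0 (suc i))

-- An item of size at most t is rejected only when the load plus t exceeds the capacity,
-- and the load never decreases afterwards.
greedyFrom-packsAll⊎overflows : ∀ t l n {x : Fin n → ℚ} →
  (∀ i → 0ℚ ≤ x i) → (∀ i → x i ≤ t) →
  l + sumFin n x ≡ greedyFrom l n x ⊎ 1ℚ < greedyFrom l n x + t
greedyFrom-packsAll⊎overflows t l zero    x≥0 x≤t = inj₁ (+-identityʳ l)
greedyFrom-packsAll⊎overflows t l (suc n) {x} x≥0 x≤t with l + x zero ≤? 1ℚ
... | no l+x₀≰1 =
  inj₂ (<-≤-trans (≰⇒> l+x₀≰1)
    (+-mono-≤ (greedyFrom-≥-load l n (λ i → x≥0 (suc i))) (x≤t zero)))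
... | yes _ with greedyFrom-packsAll⊎overflows t (l + x zero) n (λ i → x≥0 (suc i)) (λ i → x≤t (suc i))
...   | inj₁ packsAll  = inj₁ (trans (sym (+-assoc l (x zero) _)) packsAll)
...   | inj₂ overflows = inj₂ overflows

overflow⇒half-δ≤load : ∀ δ g → 1ℚ < g + (½ + δ) → ½ - δ ≤ g
overflow⇒half-δ≤load δ g overflow = begin
  ½ - δ                   ≡⟨ solve 1 (λ d → con ½ :- d := con 1ℚ :- (con ½ :+ d)) refl δ ⟩
  1ℚ - (½ + δ)            <⟨ +-monoˡ-< (- (½ + δ)) overflow ⟩
  g + (½ + δ) - (½ + δ)   ≡⟨ solve 2 (λ d h → h :+ (con ½ :+ d) :- (con ½ :+ d) := h) refl δ g ⟩
  g                       ∎
  where open ≤-Reasoning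

largeGain-bound : ∀ δ {s g} → s ≤ 1ℚ → δ + δ ≤ 1ℚ → ½ - δ ≤ g →
  s * (1ℚ - (δ + δ)) ≤ (1ℚ + 1ℚ) * g
largeGain-bound δ {s} {g} s≤1 2δ≤1 half-δ≤g = begin
  s * (1ℚ - (δ + δ))    ≤⟨ *-monoʳ-≤-nonNeg (1ℚ - (δ + δ)) {{nonNegative 1-2δ≥0}} s≤1 ⟩
  1ℚ * (1ℚ - (δ + δ))   ≡⟨ solve 1 (λ d → con 1ℚ :* (con 1ℚ :- (d :+ d))
                                          := (con 1ℚ :+ con 1ℚ) :* (con ½ :- d)) refl δ ⟩
  (1ℚ + 1ℚ) * (½ - δ)   ≤⟨ *-monoˡ-≤-nonNeg (1ℚ + 1ℚ) half-δ≤g ⟩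
  (1ℚ + 1ℚ) * g         ∎
  where
  open ≤-Reasoning
  1-2δ≥0 : 0ℚ ≤ 1ℚ - (δ + δ)
  1-2δ≥0 = ≤-trans (≤-reflexive (sym (+-inverseʳ (δ + δ)))) (+-monoˡ-≤ (- (δ + δ)) 2δ≤1)

dominatedGain-bound : ∀ {s δ g} → 0ℚ ≤ δ → 0ℚ ≤ s → s ≤ g →
  s * (1ℚ - (δ + δ)) ≤ (1ℚ + 1ℚ) * g
dominatedGain-bound {s} {δ} {g} δ≥0 s≥0 s≤g = begin
  s * (1ℚ - (δ + δ))   ≤⟨ *-monoˡ-≤-nonNeg s {{nonNegative s≥0}} 1-2δ≤1 ⟩
  s * 1ℚ               ≡⟨ *-identityʳ s ⟩
  s                    ≤⟨ s≤g ⟩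
  g                    ≤⟨ p≤p+q g (≤-trans s≥0 s≤g) ⟩
  g + g                ≡⟨ solve 1 (λ h → h :+ h := (con 1ℚ :+ con 1ℚ) :* h) refl g ⟩
  (1ℚ + 1ℚ) * g        ∎
  where
  open ≤-Reasoning
  1-2δ≤1 : 1ℚ - (δ + δ) ≤ 1ℚ
  1-2δ≤1 = ≤-trans (p≤p+q (1ℚ - (δ + δ)) (+-mono-≤ δ≥0 δ≥0))
    (≤-reflexive (solve 1 (λ d → con 1ℚ :- (d :+ d) :+ (d :+ d) := con 1ℚ) refl δ))

theorem8 : (δ : ℚ) → 0ℚ < δ → δ < ½ →
    (n : ℕ) (x x' : Fin n → ℚ) → ValidInstance δ n x x' →
    (g : ℚ) → AlgGain n x x' g →
    (S : Fin n → Bool) → Feasible n x S →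
    subsetSum n x S * (1ℚ - (δ + δ)) ≤ (1ℚ + 1ℚ) * g
theorem8 δ δ>0 δ<½ n x x' valid g alg S feasible = bound alg
  where
  2δ≤1 : δ + δ ≤ 1ℚ
  2δ≤1 = <⇒≤ (+-mono-< δ<½ δ<½)
  x≥0 : ∀ i → 0ℚ ≤ x i
  x≥0 i with valid i
  ... | x≥0ᵢ , _ = x≥0ᵢ
  bound : AlgGain n x x' g → subsetSum n x S * (1ℚ - (δ + δ)) ≤ (1ℚ + 1ℚ) * g
  bound (inj₁ (j , _ , ½≤x'ⱼ , refl)) with valid j
  ... | _ , _ , x'ⱼ-δ≤xⱼ , _ = largeGain-bound δ feasible 2δ≤1 (≤-trans (+-monoˡ-≤ (- δ) ½≤x'ⱼ) x'ⱼ-δ≤xⱼ)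
  bound (inj₂ (x'<½ , refl)) with greedyFrom-packsAll⊎overflows (½ + δ) 0ℚ n x≥0 x≤½+δ
    where
    x≤½+δ : ∀ i → x i ≤ ½ + δ
    x≤½+δ i with valid i
    ... | _ , _ , _ , xᵢ≤x'ᵢ+δ = ≤-trans xᵢ≤x'ᵢ+δ (+-monoˡ-≤ δ (<⇒≤ (x'<½ i)))
  ... | inj₁ packsAll = dominatedGain-bound (<⇒≤ δ>0) (subsetSum-nonNeg n S x≥0)
          (≤-trans (subsetSum≤sumFin n S x≥0) (≤-reflexive (trans (sym (+-identityˡ _)) packsAll)))
  ... | inj₂ overflows = largeGain-bound δ feasible 2δ≤1 (overflow⇒half-δ≤load δ (greedyGain n x) overflows)
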